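{- Let $\mathcal{R}_S \subseteq \mathcal{P}_S^2$ and $\mathcal{R}_T \subseteq \mathcal{P}_T^2$ be equivalences. An encoding $[\![\cdot]\!] : \mathcal{P}_S \to \mathcal{P}_T$ is fully abstract w.r.t. $\mathcal{R}_S$ and $\mathcal{R}_T$ and operationally corresponding w.r.t. $\mathcal{R}_T$ and $\mathcal{R}_T$ is a bisimulation iff $\exists \mathcal{R} .\ \left( \forall S .\ \left( S, [\![S]\!] \right), \left( [\![S]\!], S \right) \in \mathcal{R} \right) \wedge \mathcal{R}_S = \mathcal{R}|_{\mathcal{P}_S} \wedge \mathcal{R}_T = \mathcal{R}|_{\mathcal{P}_T} \wedge \mathcal{R}$ is a transitive bisimulation.
   Context: Source $\langle \mathcal{P}_S, \longmapsto_S\rangle$, target $\langle \mathcal{P}_T, \longmapsto_T\rangle$, encoding $[\![\cdot]\!]$; $\longmapsto^{*}$ is the reflexive transitive closure of $\longmapsto$; $\mathcal{R}\subseteq(\mathcal{P}_S\uplus\mathcal{P}_T)^2$, $\mathcal{R}|_{B'}$ its restriction to pairs in $B'$. Full abstraction: for all $S_1,S_2$, $(S_1,S_2)\in\mathcal{R}_S$ iff $([\![S_1]\!],[\![S_2]\!])\in\mathcal{R}_T$. Operational correspondence w.r.t. $\mathcal{R}_T$: $S\longmapsto_S^{*}S'$ implies $\exists T.\ [\![S]\!]\longmapsto_T^{*}T\wedge([\![S']\!],T)\in\mathcal{R}_T$, and $[\![S]\!]\longmapsto_T^{*}T$ implies $\exists S'.\ S\longmapsto_S^{*}S'\wedge([\![S']\!],T)\in\mathcal{R}_T$.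 Bisimulation: for $(P,Q)\in\mathcal{R}$, $P\longmapsto^{*}P'$ implies $\exists Q'.\ Q\longmapsto^{*}Q'\wedge(P',Q')\in\mathcal{R}$, and $Q\longmapsto^{*}Q'$ implies $\exists P'.\ P\longmapsto^{*}P'\wedge(P',Q')\in\mathcal{R}$. -}

module Defs where

open import Level using (Level; _⊔_)
open import Data.Sum using (_⊎_; inj₁; inj₂)
open import Data.Product using (_×_; ∃; ∃-syntax; _,_)
open import Relation.Binary.Core using (Rel)
open import Relation.Binary.Definitions using (Transitive)
open import Relation.Binary.Construct.Closure.ReflexiveTransitive using (Star)
open import Function.Bundles using (_⇔_)

record Calculus (ℓ : Level) : Set (Level.suc ℓ) where
  field
    Proc : Set ℓ
    _⟼_  : Rel Proc ℓ

module _ {ℓ : Level} where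

  Steps* : (C : Calculus ℓ) → Rel (Calculus.Proc C) ℓ
  Steps* C = Star (Calculus._⟼_ C)

  FullyAbstract : (S T : Calculus ℓ) → (Calculus.Proc S → Calculus.Proc T)
                → Rel (Calculus.Proc S) ℓ → Rel (Calculus.Proc T) ℓ → Set ℓ
  FullyAbstract S T ⟦_⟧ RS RT = ∀ S₁ S₂ → (RS S₁ S₂ ⇔ RT ⟦ S₁ ⟧ ⟦ S₂ ⟧)

  OpCorr : (S T : Calculus ℓ) → (Calculus.Proc S → Calculus.Proc T)
         → Rel (Calculus.Proc T) ℓ → Set ℓ
  OpCorr S T ⟦_⟧ RT =
      (∀ s s' → (Steps* S) s s' → ∃[ t ] ((Steps* T) ⟦ s ⟧ t × RT ⟦ s' ⟧ t))
    × (∀ s t → (Steps* T) ⟦ s ⟧ t → ∃[ s' ] ((Steps* S) s s' × RT ⟦ s' ⟧ t))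

  Bisimulation : (C : Calculus ℓ) → Rel (Calculus.Proc C) ℓ → Set ℓ
  Bisimulation C R = ∀ P Q → R P Q →
      (∀ P' → (Steps* C) P P' → ∃[ Q' ] ((Steps* C) Q Q' × R P' Q'))
    × (∀ Q' → (Steps* C) Q Q' → ∃[ P' ] ((Steps* C) P P' × R P' Q'))

  data UnionStep (S T : Calculus ℓ) : Rel (Calculus.Proc S ⊎ Calculus.Proc T) ℓ where
    stepS : ∀ {P P'} → Calculus._⟼_ S P P' → UnionStep S T (inj₁ P) (inj₁ P')
    stepT : ∀ {P P'} → Calculus._⟼_ T P P' → UnionStep S T (inj₂ P) (inj₂ P')

  UnionCalc : Calculus ℓ → Calculus ℓ → Calculus ℓ
  UnionCalc S T = record { Proc = Calculus.Proc S ⊎ Calculus.Proc T ; _⟼_ = UnionStep S T }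

  RestrictS : (S T : Calculus ℓ) → Rel (Calculus.Proc S ⊎ Calculus.Proc T) ℓ
            → Rel (Calculus.Proc S) ℓ → Set ℓ
  RestrictS S T R RS = ∀ P Q → (RS P Q ⇔ R (inj₁ P) (inj₁ Q))

  RestrictT : (S T : Calculus ℓ) → Rel (Calculus.Proc S ⊎ Calculus.Proc T) ℓ
            → Rel (Calculus.Proc T) ℓ → Set ℓ
  RestrictT S T R RT = ∀ P Q → (RT P Q ⇔ R (inj₂ P) (inj₂ Q))

module Submission where

open import Defs
open import Level using (Level)
open import Data.Sum using (_⊎_; inj₁; inj₂; [_,_])
open import Data.Product using (_×_; ∃-syntax; _,_; proj₁; proj₂)
open import Function.Base using (id; _on_)
open import Function.Bundles using (_⇔_; mk⇔; Equivalence)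
open import Function.Construct.Composition using (_⇔-∘_)
open import Function.Construct.Identity using (⇔-id)
open import Function.Construct.Symmetry using (⇔-sym)
open import Relation.Binary.Core using (Rel; _⇒_)
open import Relation.Binary.Structures using (IsEquivalence)
open import Relation.Binary.Definitions using (Reflexive; Symmetric; Transitive)
open import Relation.Binary.PropositionalEquality using (_≡_; refl)
open import Relation.Binary.Construct.Closure.ReflexiveTransitive using (ε; _◅_; gmap)

-- For the forward direction take R to be R_T pulled back along [ ⟦_⟧ , id ] : P_S ⊎ P_T → P_T:
-- operational correspondence is exactly what makes this pullback a bisimulation, and full
-- abstraction makes its restriction to P_S equal to R_S.  Conversely, in a transitive
-- bisimulation on P_S ⊎ P_T relating each S with ⟦ S ⟧ both ways, S and ⟦ S ⟧ are
-- interchangeable; this gives full abstraction and operational correspondence, and the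
-- restriction to P_T is again a bisimulation.

module _ {ℓ : Level} where

  Simulation : (C : Calculus ℓ) → Rel (Calculus.Proc C) ℓ → Set ℓ
  Simulation C R = ∀ P Q → R P Q → ∀ P' → Steps* C P P' → ∃[ Q' ] (Steps* C Q Q' × R P' Q')

  symmetric-simulation⇒bisimulation : ∀ {C R} → Symmetric R → Simulation C R → Bisimulation C R
  symmetric-simulation⇒bisimulation sym sim P Q r = sim P Q r , λ Q' st →
    let P' , st' , r' = sim Q P (sym r) Q' st in P' , st' , sym r'

  bisimulation-resp-⇔ : ∀ {C} {R₁ R₂ : Rel (Calculus.Proc C) ℓ} →
                        (∀ P Q → R₁ P Q ⇔ R₂ P Q) → Bisimulation C R₁ → Bisimulation C R₂
  bisimulation-resp-⇔ R₁⇔R₂ bis P Q r =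
    let left , right = bis P Q (Equivalence.from (R₁⇔R₂ P Q) r)
    in (λ P' st → let Q' , st' , r' = left P' st in Q' , st' , Equivalence.to (R₁⇔R₂ P' Q') r')
     , (λ Q' st → let P' , st' , r' = right Q' st in P' , st' , Equivalence.to (R₁⇔R₂ P' Q') r')

  opCorr-mono : ∀ {S T e} {R₁ R₂ : Rel (Calculus.Proc T) ℓ} →
                R₁ ⇒ R₂ → OpCorr S T e R₁ → OpCorr S T e R₂
  opCorr-mono R₁⇒R₂ (complete , sound) =
      (λ s s' st → let t , st' , r = complete s s' st in t , st' , R₁⇒R₂ r)
    , (λ s t st → let s' , st' , r = sound s t st in s' , st' , R₁⇒R₂ r)

  pullback-bisimulation : ∀ {A T} {RT : Rel (Calculus.Proc T) ℓ}
                            {e : Calculus.Proc A → Calculus.Proc T} →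
                          IsEquivalence RT → Bisimulation T RT → OpCorr A T e RT →
                          Bisimulation A (RT on e)
  pullback-bisimulation {RT = RT} {e} isEq bis (complete , sound) =
    symmetric-simulation⇒bisimulation sym simulate
    where
    open IsEquivalence isEq
    simulate : Simulation _ (RT on e)
    simulate P Q r P' st =
      let t  , eP→t   , rP't  = complete P P' st
          t' , eQ→t'  , rtt'  = proj₁ (bis (e P) (e Q) r) t eP→t
          Q' , Q→Q'   , rQ't' = sound Q t' eQ→t'
      in Q' , Q→Q' , trans (trans rP't rtt') (sym rQ't')

module _ {ℓ : Level} (S T : Calculus ℓ) where

  private
    U = UnionCalc S T

  inj₁-steps : ∀ {s s'} → Steps* S s s' → Steps* U (inj₁ s) (inj₁ s')
  inj₁-steps = gmap inj₁ stepS

  inj₂-steps : ∀ {t t'} → Steps* T t t' → Steps* U (inj₂ t) (inj₂ t')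
  inj₂-steps = gmap inj₂ stepT

  inj₁-steps⁻¹ : ∀ {s P} → Steps* U (inj₁ s) P → ∃[ s' ] (P ≡ inj₁ s' × Steps* S s s')
  inj₁-steps⁻¹ ε = _ , refl , ε
  inj₁-steps⁻¹ (stepS st ◅ sts) with inj₁-steps⁻¹ sts
  ... | s' , refl , sts' = s' , refl , st ◅ sts'

  inj₂-steps⁻¹ : ∀ {t P} → Steps* U (inj₂ t) P → ∃[ t' ] (P ≡ inj₂ t' × Steps* T t t')
  inj₂-steps⁻¹ ε = _ , refl , ε
  inj₂-steps⁻¹ (stepT st ◅ sts) with inj₂-steps⁻¹ sts
  ... | t' , refl , sts' = t' , refl , st ◅ sts'

  opCorr-⊎ : ∀ {⟦_⟧ RT} → Reflexive RT → OpCorr S T ⟦_⟧ RT → OpCorr U T [ ⟦_⟧ , id ] RT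
  opCorr-⊎ {⟦_⟧} {RT} refl′ (complete , sound) = complete⊎ , sound⊎
    where
    complete⊎ : ∀ P P' → Steps* U P P' → ∃[ t ] (Steps* T ([ ⟦_⟧ , id ] P) t × RT ([ ⟦_⟧ , id ] P') t)
    complete⊎ (inj₁ s) P' st with inj₁-steps⁻¹ st
    ... | s' , refl , st' = complete s s' st'
    complete⊎ (inj₂ t) P' st with inj₂-steps⁻¹ st
    ... | t' , refl , st' = t' , st' , refl′

    sound⊎ : ∀ P t → Steps* T ([ ⟦_⟧ , id ] P) t → ∃[ P' ] (Steps* U P P' × RT ([ ⟦_⟧ , id ] P') t)
    sound⊎ (inj₁ s) t st = let s' , st' , r = sound s t st in inj₁ s' , inj₁-steps st' , r
    sound⊎ (inj₂ _) t st = inj₂ t , inj₂-steps st , refl′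

  bisimulation-restrict₂ : ∀ {R} → Bisimulation U R → Bisimulation T (R on inj₂)
  bisimulation-restrict₂ {R} bis t₁ t₂ r = left , right
    where
    left : ∀ t₁' → Steps* T t₁ t₁' → ∃[ t₂' ] (Steps* T t₂ t₂' × R (inj₂ t₁') (inj₂ t₂'))
    left t₁' st with proj₁ (bis _ _ r) (inj₂ t₁') (inj₂-steps st)
    ... | Q' , st' , r' with inj₂-steps⁻¹ st'
    ... | t₂' , refl , st'' = t₂' , st'' , r'

    right : ∀ t₂' → Steps* T t₂ t₂' → ∃[ t₁' ] (Steps* T t₁ t₁' × R (inj₂ t₁') (inj₂ t₂'))
    right t₂' st with proj₂ (bis _ _ r) (inj₂ t₂') (inj₂-steps st)
    ... | P' , st' , r' with inj₂-steps⁻¹ st'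
    ... | t₁' , refl , st'' = t₁' , st'' , r'

  Characterises : Rel (Calculus.Proc S) ℓ → Rel (Calculus.Proc T) ℓ →
                  (Calculus.Proc S → Calculus.Proc T) → Rel (Calculus.Proc U) ℓ → Set ℓ
  Characterises RS RT ⟦_⟧ R = (∀ s → R (inj₁ s) (inj₂ ⟦ s ⟧) × R (inj₂ ⟦ s ⟧) (inj₁ s))
                            × RestrictS S T R RS
                            × RestrictT S T R RT
                            × Transitive R
                            × Bisimulation U R

  module _ {R : Rel (Calculus.Proc U) ℓ} {⟦_⟧ : Calculus.Proc S → Calculus.Proc T}
           (trans : Transitive R)
           (encoding-related : ∀ s → R (inj₁ s) (inj₂ ⟦ s ⟧) × R (inj₂ ⟦ s ⟧) (inj₁ s)) where

    related-⇔-encodings-related : ∀ s₁ s₂ → R (inj₁ s₁) (inj₁ s₂) ⇔ R (inj₂ ⟦ s₁ ⟧) (inj₂ ⟦ s₂ ⟧)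
    related-⇔-encodings-related s₁ s₂ = mk⇔
      (λ r → trans (proj₂ (encoding-related s₁)) (trans r (proj₁ (encoding-related s₂))))
      (λ r → trans (proj₁ (encoding-related s₁)) (trans r (proj₂ (encoding-related s₂))))

    opCorr-restrict₂ : Bisimulation U R → OpCorr S T ⟦_⟧ (R on inj₂)
    opCorr-restrict₂ bis = complete , sound
      where
      complete : ∀ s s' → Steps* S s s' → ∃[ t ] (Steps* T ⟦ s ⟧ t × R (inj₂ ⟦ s' ⟧) (inj₂ t))
      complete s s' st with proj₁ (bis _ _ (proj₁ (encoding-related s))) (inj₁ s') (inj₁-steps st)
      ... | Q' , st' , r with inj₂-steps⁻¹ st'
      ... | t , refl , st'' = t , st'' , trans (proj₂ (encoding-related s')) r

      sound : ∀ s t → Steps* T ⟦ s ⟧ t → ∃[ s' ] (Steps* S s s' × R (inj₂ ⟦ s' ⟧) (inj₂ t))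
      sound s t st with proj₂ (bis _ _ (proj₁ (encoding-related s))) (inj₂ t) (inj₂-steps st)
      ... | P' , st' , r with inj₁-steps⁻¹ st'
      ... | s' , refl , st'' = s' , st'' , trans (proj₂ (encoding-related s')) r

lemma15 : {ℓ : Level} (S T : Calculus ℓ)
          (RS : Rel (Calculus.Proc S) ℓ) (RT : Rel (Calculus.Proc T) ℓ)
          → IsEquivalence RS → IsEquivalence RT
          → (⟦_⟧ : Calculus.Proc S → Calculus.Proc T)
          → ((FullyAbstract S T ⟦_⟧ RS RT × OpCorr S T ⟦_⟧ RT × Bisimulation T RT)
             ⇔ (∃[ R ] ((∀ s → R (inj₁ s) (inj₂ ⟦ s ⟧) × R (inj₂ ⟦ s ⟧) (inj₁ s))
                        × RestrictS S T R RS
                        × RestrictT S T R RT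
                        × Transitive R
                        × Bisimulation (UnionCalc S T) R)))
lemma15 S T RS RT _ isEqT ⟦_⟧ = mk⇔ forward backward
  where
  module ET = IsEquivalence isEqT

  forward : FullyAbstract S T ⟦_⟧ RS RT × OpCorr S T ⟦_⟧ RT × Bisimulation T RT →
            ∃[ R ] Characterises S T RS RT ⟦_⟧ R
  forward (fullyAbstract , opCorr , bis) =
      (RT on [ ⟦_⟧ , id ])
    , (λ _ → ET.refl , ET.refl)
    , fullyAbstract
    , (λ _ _ → ⇔-id _)
    , ET.trans
    , pullback-bisimulation isEqT bis (opCorr-⊎ S T {RT = RT} ET.refl opCorr)

  backward : ∃[ R ] Characterises S T RS RT ⟦_⟧ R →
             FullyAbstract S T ⟦_⟧ RS RT × OpCorr S T ⟦_⟧ RT × Bisimulation T RT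
  backward (R , encoding-related , restrictS , restrictT , transR , bis) =
      (λ s₁ s₂ → ⇔-sym (restrictT _ _)
                   ⇔-∘ (related-⇔-encodings-related S T {R = R} transR encoding-related s₁ s₂
                   ⇔-∘ restrictS s₁ s₂))
    , opCorr-mono (λ {t t'} → Equivalence.from (restrictT t t'))
                  (opCorr-restrict₂ S T {R = R} transR encoding-related bis)
    , bisimulation-resp-⇔ (λ P Q → ⇔-sym (restrictT P Q)) (bisimulation-restrict₂ S T bis)
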